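{- Let $E$ be a finite set, let $f:2^E\to\mathbb{R}$ be a submodular function and $g:2^E\to\mathbb{R}$ a supermodular function with $f(\emptyset)=g(\emptyset)=0$. Then $\mathrm{P}(f,g)=\{x\in\mathbb{R}^E\mid \forall X\subseteq E:\ g(X)\le x(X)\le f(X)\}$ is a generalized polymatroid, i.e. the pair $(f,g)$ satisfies $$f(X)-g(Y)\ge f(X\setminus Y)-g(Y\setminus X)\qquad(\forall X,Y\subseteq E),$$ if and only if the ordered pair $(f,g^{\#})$ is a strong map.
   Context: For $x\in\mathbb{R}^E$ and $X\subseteq E$, $x(X)=\sum_{e\in X}x(e)$, $x(\emptyset)=0$. A function $f:2^E\to\mathbb{R}$ is submodular if $f(X)+f(Y)\ge f(X\cup Y)+f(X\cap Y)$ for all $X,Y\subseteq E$; its negative is supermodular. The dual of a set function $h$ is $h^{\#}(X)=h(E)-h(E\setminus X)$; for supermodular $g$, $g^{\#}$ is submodular. For submodular $h$, $\mathrm{P}(h)=\{x\in\mathbb{R}^E\mid \forall X\subseteq E: x(X)\le h(X)\}$. For submodular $h$ and $A\subseteq E$ with $A\neq E$, the contraction $h_A:2^{E\setminus A}\to\mathbb{R}$ is $h_A(X)=h(X\cup A)-h(A)$ (so $h_\emptyset=h$). An ordered pair $(f_1,f_2)$ of submodular functions on $2^E$ is a strong map if $\mathrm{P}((f_2)_X)\subseteq \mathrm{P}((f_1)_X)$ for every proper subset $X\subset E$. -}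

module Defs where

open import Level using (Level; _⊔_) renaming (suc to lsuc)
open import Data.Nat using (ℕ; zero; suc)
open import Data.Fin using (Fin) renaming (zero to fzero; suc to fsuc)
open import Data.Vec using (_∷_; [])
open import Data.Bool using (true; false)
open import Data.Fin.Subset using (Subset; ⊥; ⊤; ∁; _∪_; _∩_; _─_; _⊂_)
open import Data.Product using (∃; _×_)
open import Relation.Nullary using (¬_)
open import Relation.Binary using (Rel; IsTotalOrder)
open import Relation.Binary.PropositionalEquality using (_≡_)
open import Algebra.Bundles using (CommutativeRing)

-- A (totally) ordered field.  The paper works over ℝ; ℝ is an instance,
-- so stating the theorem for every ordered field generalizes it
-- (stdlib has no real numbers).
record OrderedField (c ℓ₁ ℓ₂ : Level) : Set (lsuc (c ⊔ ℓ₁ ⊔ ℓ₂)) where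
  field
    commutativeRing : CommutativeRing c ℓ₁
  open CommutativeRing commutativeRing public
  infix 4 _≤_
  field
    _≤_          : Rel Carrier ℓ₂
    isTotalOrder : IsTotalOrder _≈_ _≤_
    +-mono-≤     : ∀ {x y} z → x ≤ y → x + z ≤ y + z
    *-nonneg     : ∀ {x y} → 0# ≤ x → 0# ≤ y → 0# ≤ x * y
    nontrivial   : ¬ (1# ≈ 0#)
    inverse      : ∀ x → ¬ (x ≈ 0#) → ∃ λ y → x * y ≈ 1#

module _ {c ℓ₁ ℓ₂ : Level} (F : OrderedField c ℓ₁ ℓ₂) where
  open OrderedField F

  sumOver : ∀ {n} → Subset n → (Fin n → Carrier) → Carrier
  sumOver []          x = 0#
  sumOver (true  ∷ X) x = x fzero + sumOver X (λ i → x (fsuc i))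
  sumOver (false ∷ X) x = sumOver X (λ i → x (fsuc i))

  Submodular : ∀ {n} → (Subset n → Carrier) → Set ℓ₂
  Submodular f = ∀ X Y → f (X ∪ Y) + f (X ∩ Y) ≤ f X + f Y

  Supermodular : ∀ {n} → (Subset n → Carrier) → Set ℓ₂
  Supermodular g = ∀ X Y → g X + g Y ≤ g (X ∪ Y) + g (X ∩ Y)

  dual : ∀ {n} → (Subset n → Carrier) → Subset n → Carrier
  dual h X = h ⊤ - h (∁ X)

  -- Vectors of ℝ^(E∖A) are represented by vectors on E
  -- whose coordinates on A are ignored (x(Y) only reads coordinates in Y,
  -- and Y ranges over subsets disjoint from A).
  InContractionPolytope : ∀ {n} → (Subset n → Carrier) → Subset n
                        → (Fin n → Carrier) → Set ℓ₂
  InContractionPolytope h A x =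
    ∀ Y → Y ∩ A ≡ ⊥ → sumOver Y x ≤ h (Y ∪ A) - h A

  StrongMap : ∀ {n} → (Subset n → Carrier) → (Subset n → Carrier) → Set (c ⊔ ℓ₂)
  StrongMap f₁ f₂ = ∀ X → X ⊂ ⊤ → ∀ x →
    InContractionPolytope f₂ X x → InContractionPolytope f₁ X x

  GeneralizedPolymatroid : ∀ {n} → (Subset n → Carrier) → (Subset n → Carrier) → Set ℓ₂
  GeneralizedPolymatroid f g = ∀ X Y → f (X ─ Y) - g (Y ─ X) ≤ f X - g Y

module Submission where

open import Defs
open import Level using (Level; _⊔_)
open import Data.Nat using (ℕ; suc)
open import Data.Fin using (Fin)
open import Data.Bool using (Bool; true; false)
open import Data.Bool.Properties using (∧-identityʳ; ∧-zeroʳ)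
open import Data.Vec using (_∷_; [])
open import Data.Vec.Functional using () renaming (_∷_ to _∷ᶠ_)
open import Data.Fin.Subset using (Subset; ⊥; ⊤; ∁; _∪_; _∩_; _─_; _⊂_; Nonempty)
open import Data.Fin.Subset.Properties
  using ( ∪-identityˡ; ∪-identityʳ; ∪-zeroʳ; ∩-identityʳ; ∩-zeroˡ; ∩-zeroʳ; ∪-distribʳ-∩
        ; p─⊥≡p; ∪-idempotentCommutativeMonoid; ∪-∩-booleanAlgebra
        ; nonempty?; Empty-unique; ⊆⊤; ∈⊤; x∈p⇒x∉∁p )
open import Data.Product using (_×_; _,_)
open import Relation.Nullary using (yes; no)
open import Relation.Binary using (Poset; IsTotalOrder)
open import Relation.Binary.PropositionalEquality
  using (_≡_; refl; sym; trans; cong; cong₂; subst; subst₂; module ≡-Reasoning)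
import Algebra.Lattice.Properties.BooleanAlgebra as BooleanAlgebraProperties
import Algebra.Properties.AbelianGroup as AbelianGroupProperties
import Algebra.Solver.CommutativeMonoid as CommutativeMonoidSolver
import Algebra.Solver.IdempotentCommutativeMonoid as IdempotentCommutativeMonoidSolver
import Relation.Binary.Reasoning.PartialOrder as PartialOrderReasoning

-- (⇒) For A ⊂ E and Y disjoint from A, membership of x in P(g#_A) bounds x(Y)
--     by g#(Y ∪ A) - g#(A) = g(E∖A) - g(E∖(Y ∪ A)), and the generalized
--     polymatroid inequality for the pair (Y ∪ A, E∖A) bounds this by
--     f(Y ∪ A) - f(A), the constraint of P(f_A) for Y.
-- (⇐) Let X, Y ⊆ E.  If Y = ∅ there is nothing to prove.  Otherwise A = E∖Y is a
--     proper subset; the greedy algorithm yields a point x of P(g#_A) that is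
--     tight on W = X ∩ Y, i.e. x(W) = g(Y) - g(Y∖X).  The strong map puts x in
--     P(f_A), so g(Y) - g(Y∖X) ≤ f(X ∪ (E∖Y)) - f(E∖Y), and submodularity of f
--     on X and E∖Y turns this into f(X∖Y) - g(Y∖X) ≤ f(X) - g(Y).

module SubsetAlgebra {n : ℕ} = BooleanAlgebraProperties (∪-∩-booleanAlgebra n)

Coordinatewise : (∀ {n} → Subset n → Subset n → Subset n) → (Bool → Bool → Bool) → Set
Coordinatewise F φ = ∀ {n} a b (X Y : Subset n) → F (a ∷ X) (b ∷ Y) ≡ φ a b ∷ F X Y

-- Two coordinatewise operations agree once they agree on single bits: every
-- Boolean identity between subset expressions is checked on its truth table.
bitwise : (F G : ∀ {n} → Subset n → Subset n → Subset n) {φ ψ : Bool → Bool → Bool}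
        → Coordinatewise F φ → Coordinatewise G ψ
        → φ false false ≡ ψ false false → φ false true ≡ ψ false true
        → φ true false ≡ ψ true false → φ true true ≡ ψ true true
        → ∀ {n} (X Y : Subset n) → F X Y ≡ G X Y
bitwise F G F-step G-step ff ft tf tt [] [] with F [] [] | G [] []
... | [] | [] = refl
bitwise F G {φ} {ψ} F-step G-step ff ft tf tt (a ∷ X) (b ∷ Y) = begin
    F (a ∷ X) (b ∷ Y)  ≡⟨ F-step a b X Y ⟩
    φ a b ∷ F X Y      ≡⟨ cong₂ _∷_ (on-bits a b) (bitwise F G F-step G-step ff ft tf tt X Y) ⟩
    ψ a b ∷ G X Y      ≡⟨ G-step a b X Y ⟨
    G (a ∷ X) (b ∷ Y)  ∎
  where
  open ≡-Reasoning
  on-bits : ∀ a b → φ a b ≡ ψ a b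
  on-bits false false = ff
  on-bits false true  = ft
  on-bits true  false = tf
  on-bits true  true  = tt

-- The library defines _─_
-- through a local helper, so its coordinate steps do not hold by computation;
-- differences are therefore rewritten with this lemma before using bitwise.
minus-as-meet : ∀ {n} (X Y : Subset n) → X ─ Y ≡ X ∩ ∁ Y
minus-as-meet []      []          = refl
minus-as-meet (x ∷ X) (false ∷ Y) = cong₂ _∷_ (sym (∧-identityʳ x)) (minus-as-meet X Y)
minus-as-meet (x ∷ X) (true  ∷ Y) = cong₂ _∷_ (sym (∧-zeroʳ x)) (minus-as-meet X Y)

meet-union-double-complement : ∀ {n} (Y A : Subset n) → (Y ∪ A) ∩ ∁ (∁ A) ≡ A
meet-union-double-complement = bitwise (λ Y A → (Y ∪ A) ∩ ∁ (∁ A)) (λ _ A → A)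
  (λ _ _ _ _ → refl) (λ _ _ _ _ → refl) refl refl refl refl

complement-meet-absorb : ∀ {n} (Y A : Subset n) → ∁ A ∩ ∁ (Y ∪ A) ≡ ∁ (Y ∪ A)
complement-meet-absorb = bitwise (λ Y A → ∁ A ∩ ∁ (Y ∪ A)) (λ Y A → ∁ (Y ∪ A))
  (λ _ _ _ _ → refl) (λ _ _ _ _ → refl) refl refl refl refl

meet-join-complement : ∀ {n} (X Y : Subset n) → (X ∩ Y) ∪ ∁ Y ≡ X ∪ ∁ Y
meet-join-complement = bitwise (λ X Y → (X ∩ Y) ∪ ∁ Y) (λ X Y → X ∪ ∁ Y)
  (λ _ _ _ _ → refl) (λ _ _ _ _ → refl) refl refl refl refl

meet-disjoint-complement : ∀ {n} (X Y : Subset n) → (X ∩ Y) ∩ ∁ Y ≡ ⊥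
meet-disjoint-complement = bitwise (λ X Y → (X ∩ Y) ∩ ∁ Y) (λ _ _ → ⊥)
  (λ _ _ _ _ → refl) (λ _ _ _ _ → refl) refl refl refl refl

complement-meet-join-complement : ∀ {n} (X Y : Subset n) → ∁ ((X ∩ Y) ∪ ∁ Y) ≡ Y ∩ ∁ X
complement-meet-join-complement = bitwise (λ X Y → ∁ ((X ∩ Y) ∪ ∁ Y)) (λ X Y → Y ∩ ∁ X)
  (λ _ _ _ _ → refl) (λ _ _ _ _ → refl) refl refl refl refl

∪-distribʳ-∪ : ∀ {n} (X Y A : Subset n) → (X ∪ Y) ∪ A ≡ (X ∪ A) ∪ (Y ∪ A)
∪-distribʳ-∪ {n} = solve 3 (λ X Y A → (X ⊕ Y) ⊕ A ⊜ (X ⊕ A) ⊕ (Y ⊕ A)) refl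
  where open IdempotentCommutativeMonoidSolver (∪-idempotentCommutativeMonoid n)

module _ {c ℓ₁ ℓ₂ : Level} (F : OrderedField c ℓ₁ ℓ₂) where
  open OrderedField F renaming (refl to ≈-refl; sym to ≈-sym; trans to ≈-trans)
  open AbelianGroupProperties +-abelianGroup using (⁻¹-anti-homo‿-; ⁻¹-∙-comm)
  open CommutativeMonoidSolver +-commutativeMonoid using (solve; _⊕_; _⊜_)

  poset : Poset c ℓ₁ ℓ₂
  poset = record { isPartialOrder = IsTotalOrder.isPartialOrder isTotalOrder }

  open Poset poset using () renaming (refl to ≤-refl; reflexive to ≤-reflexive; trans to ≤-trans)
  open PartialOrderReasoning poset

  +-mono₂-≤ : ∀ {a b c d} → a ≤ b → c ≤ d → a + c ≤ b + d
  +-mono₂-≤ {a} {b} {c} {d} a≤b c≤d = begin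
    a + c  ≤⟨ +-mono-≤ c a≤b ⟩
    b + c  ≈⟨ +-comm b c ⟩
    c + b  ≤⟨ +-mono-≤ b c≤d ⟩
    d + b  ≈⟨ +-comm d b ⟩
    b + d  ∎

  cancel : ∀ x y → x + (y - y) ≈ x
  cancel x y = ≈-trans (+-congˡ (-‿inverseʳ y)) (+-identityʳ x)

  telescope : ∀ a b c → (b - a) + (c - b) ≈ c - a
  telescope a b c = begin-equality
    (b - a) + (c - b)  ≈⟨ solve 4 (λ a⁻ b b⁻ c → (b ⊕ a⁻) ⊕ (c ⊕ b⁻) ⊜ (c ⊕ a⁻) ⊕ (b ⊕ b⁻))
                                ≈-refl (- a) b (- b) c ⟩
    (c - a) + (b - b)  ≈⟨ cancel (c - a) b ⟩
    c - a              ∎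

  -- Differences of two values of a dual function h#(X) = t - h(E∖X).
  difference-of-duals : ∀ t u v → (t - u) - (t - v) ≈ v - u
  difference-of-duals t u v =
    ≈-trans (+-congˡ (⁻¹-anti-homo‿- t v)) (telescope u t v)

  sum-of-differences : ∀ a b c d → (a - b) + (c - d) ≈ (a + c) - (b + d)
  sum-of-differences a b c d = begin-equality
    (a - b) + (c - d)      ≈⟨ solve 4 (λ a b⁻ c d⁻ → (a ⊕ b⁻) ⊕ (c ⊕ d⁻) ⊜ (a ⊕ c) ⊕ (b⁻ ⊕ d⁻))
                                    ≈-refl a (- b) c (- d) ⟩
    (a + c) + (- b - d)    ≈⟨ +-congˡ (⁻¹-∙-comm b d) ⟩
    (a + c) - (b + d)      ∎

  sum→difference : ∀ {a b c d} → a + d ≤ c + b → a - b ≤ c - d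
  sum→difference {a} {b} {c} {d} a+d≤c+b = begin
    a - b              ≈⟨ cancel (a - b) d ⟨
    (a - b) + (d - d)  ≈⟨ sum-of-differences a b d d ⟩
    (a + d) - (b + d)  ≤⟨ +-mono-≤ (- (b + d)) a+d≤c+b ⟩
    (c + b) - (b + d)  ≈⟨ +-congˡ (-‿cong (+-comm b d)) ⟩
    (c + b) - (d + b)  ≈⟨ sum-of-differences c d b b ⟨
    (c - d) + (b - b)  ≈⟨ cancel (c - d) b ⟩
    c - d              ∎

  difference→sum : ∀ {a b c d} → a - b ≤ c - d → a + d ≤ c + b
  difference→sum {a} {b} {c} {d} a-b≤c-d = begin
    a + d              ≈⟨ cancel (a + d) b ⟨
    (a + d) + (b - b)  ≈⟨ solve 4 (λ a b b⁻ d → (a ⊕ d) ⊕ (b ⊕ b⁻) ⊜ (a ⊕ b⁻) ⊕ (b ⊕ d))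
                                ≈-refl a b (- b) d ⟩
    (a - b) + (b + d)  ≤⟨ +-mono-≤ (b + d) a-b≤c-d ⟩
    (c - d) + (b + d)  ≈⟨ solve 4 (λ b c d d⁻ → (c ⊕ d⁻) ⊕ (b ⊕ d) ⊜ (c ⊕ b) ⊕ (d ⊕ d⁻))
                                ≈-refl b c d (- d) ⟩
    (c + b) + (d - d)  ≈⟨ cancel (c + b) d ⟩
    c + b              ∎

  exchange : ∀ {a b c d} → a - b ≤ c - d → d - b ≤ c - a
  exchange {a} {b} {c} {d} a-b≤c-d =
    sum→difference (≤-trans (≤-reflexive (+-comm d a)) (difference→sum a-b≤c-d))

  subtract-antitone : ∀ {p q} s → p ≤ q → s - q ≤ s - p
  subtract-antitone s p≤q = sum→difference (+-mono₂-≤ (≤-refl {s}) p≤q)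

  restrict-submodular : ∀ {n} {h : Subset (suc n) → Carrier}
                      → Submodular F h → ∀ b → Submodular F (λ Z → h (b ∷ Z))
  restrict-submodular h-sub false X Y = h-sub (false ∷ X) (false ∷ Y)
  restrict-submodular h-sub true  X Y = h-sub (true  ∷ X) (true  ∷ Y)

  -- Z ↦ h(Z ∪ A) is submodular; the contraction h_A is this function minus a constant.
  union-submodular : ∀ {n} {h : Subset n → Carrier}
                   → Submodular F h → ∀ A → Submodular F (λ Z → h (Z ∪ A))
  union-submodular {h = h} h-sub A X Y =
    subst₂ (λ U V → h U + h V ≤ h (X ∪ A) + h (Y ∪ A))
           (sym (∪-distribʳ-∪ X Y A)) (sym (∪-distribʳ-∩ A X Y))
           (h-sub (X ∪ A) (Y ∪ A))

  dual-submodular : ∀ {n} {g : Subset n → Carrier}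
                  → Supermodular F g → Submodular F (dual F g)
  dual-submodular {g = g} g-sup X Y = begin
    (t - g (∁ (X ∪ Y))) + (t - g (∁ (X ∩ Y)))  ≈⟨ sum-of-differences t _ t _ ⟩
    (t + t) - (g (∁ (X ∪ Y)) + g (∁ (X ∩ Y)))  ≤⟨ subtract-antitone (t + t) complements-supermodular ⟩
    (t + t) - (g (∁ X) + g (∁ Y))              ≈⟨ sum-of-differences t _ t _ ⟨
    (t - g (∁ X)) + (t - g (∁ Y))              ∎
    where
    t = g ⊤
    complements-supermodular : g (∁ X) + g (∁ Y) ≤ g (∁ (X ∪ Y)) + g (∁ (X ∩ Y))
    complements-supermodular = begin
      g (∁ X) + g (∁ Y)                  ≤⟨ g-sup (∁ X) (∁ Y) ⟩
      g (∁ X ∪ ∁ Y) + g (∁ X ∩ ∁ Y)      ≈⟨ +-comm _ _ ⟩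
      g (∁ X ∩ ∁ Y) + g (∁ X ∪ ∁ Y)      ≡⟨ cong₂ (λ U V → g U + g V)
                                              (sym (SubsetAlgebra.deMorgan₂ X Y))
                                              (sym (SubsetAlgebra.deMorgan₁ X Y)) ⟩
      g (∁ (X ∪ Y)) + g (∁ (X ∩ Y))      ∎

  top-marginal : ∀ {n} {h : Subset (suc n) → Carrier} → Submodular F h
               → ∀ Z → h ⊤ - h (false ∷ ⊤) ≤ h (true ∷ Z) - h (false ∷ Z)
  top-marginal {h = h} h-sub Z = sum→difference
    (subst₂ (λ U V → h (true ∷ U) + h (false ∷ V) ≤ h (true ∷ Z) + h (false ∷ ⊤))
            (∪-zeroʳ Z) (∩-identityʳ Z) (h-sub (true ∷ Z) (false ∷ ⊤)))

  bottom-marginal : ∀ {n} {h : Subset (suc n) → Carrier} → Submodular F h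
                  → ∀ Z → h (true ∷ Z) - h (true ∷ ⊥) ≤ h (false ∷ Z) - h ⊥
  bottom-marginal {h = h} h-sub Z = sum→difference
    (subst₂ (λ U V → h (true ∷ U) + h (false ∷ V) ≤ h (false ∷ Z) + h (true ∷ ⊥))
            (∪-identityʳ Z) (∩-zeroʳ Z) (h-sub (false ∷ Z) (true ∷ ⊥)))

  record TightPoint {n} (h : Subset n → Carrier) (Y : Subset n) : Set (c ⊔ ℓ₁ ⊔ ℓ₂) where
    field
      point   : Fin n → Carrier
      bounded : ∀ Z → sumOver F Z point ≤ h Z - h ⊥
      tight   : sumOver F Y point ≈ h Y - h ⊥

  -- The first coordinate gets its marginal value at ⊤ if it lies outside Y and
  -- at ∅ if it lies in Y; the remaining ones come from the restriction.
  tight-point : ∀ {n} (h : Subset n → Carrier) → Submodular F h → ∀ Y → TightPoint h Y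
  tight-point h h-sub [] = record
    { point   = λ ()
    ; bounded = λ { [] → ≤-reflexive (≈-sym (-‿inverseʳ (h []))) }
    ; tight   = ≈-sym (-‿inverseʳ (h []))
    }
  tight-point h h-sub (false ∷ Y) = record
    { point = a ∷ᶠ point ; bounded = bounded′ ; tight = tight }
    where
    open TightPoint (tight-point (λ Z → h (false ∷ Z)) (restrict-submodular h-sub false) Y)
    a = h ⊤ - h (false ∷ ⊤)
    bounded′ : ∀ Z → sumOver F Z (a ∷ᶠ point) ≤ h Z - h ⊥
    bounded′ (false ∷ Z) = bounded Z
    bounded′ (true  ∷ Z) = begin
      a + sumOver F Z point                                 ≤⟨ +-mono₂-≤ (top-marginal h-sub Z) (bounded Z) ⟩
      (h (true ∷ Z) - h (false ∷ Z)) + (h (false ∷ Z) - h ⊥) ≈⟨ +-comm _ _ ⟩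
      (h (false ∷ Z) - h ⊥) + (h (true ∷ Z) - h (false ∷ Z)) ≈⟨ telescope _ _ _ ⟩
      h (true ∷ Z) - h ⊥                                    ∎
  tight-point h h-sub (true ∷ Y) = record
    { point = a ∷ᶠ point ; bounded = bounded′ ; tight = tight′ }
    where
    open TightPoint (tight-point (λ Z → h (true ∷ Z)) (restrict-submodular h-sub true) Y)
    a = h (true ∷ ⊥) - h ⊥
    bounded′ : ∀ Z → sumOver F Z (a ∷ᶠ point) ≤ h Z - h ⊥
    bounded′ (false ∷ Z) = ≤-trans (bounded Z) (bottom-marginal h-sub Z)
    bounded′ (true  ∷ Z) = begin
      a + sumOver F Z point                  ≤⟨ +-mono₂-≤ (≤-refl {a}) (bounded Z) ⟩
      a + (h (true ∷ Z) - h (true ∷ ⊥))      ≈⟨ telescope _ _ _ ⟩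
      h (true ∷ Z) - h ⊥                     ∎
    tight′ : a + sumOver F Y point ≈ h (true ∷ Y) - h ⊥
    tight′ = ≈-trans (+-congˡ tight) (telescope _ _ _)

  gp⇒strong-map : ∀ {n} (f g : Subset n → Carrier)
                → GeneralizedPolymatroid F f g → StrongMap F f (dual F g)
  gp⇒strong-map f g gp A _ x x∈P Y Y∩A≡∅ = begin
    sumOver F Y x                    ≤⟨ x∈P Y Y∩A≡∅ ⟩
    dual F g (Y ∪ A) - dual F g A    ≈⟨ difference-of-duals (g ⊤) _ _ ⟩
    g (∁ A) - g (∁ (Y ∪ A))          ≤⟨ exchange gp-instance ⟩
    f (Y ∪ A) - f A                  ∎
    where
    gp-instance : f A - g (∁ (Y ∪ A)) ≤ f (Y ∪ A) - g (∁ A)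
    gp-instance =
      subst₂ (λ U V → f U - g V ≤ f (Y ∪ A) - g (∁ A))
             (trans (minus-as-meet (Y ∪ A) (∁ A)) (meet-union-double-complement Y A))
             (trans (minus-as-meet (∁ A) (Y ∪ A)) (complement-meet-absorb Y A))
             (gp (Y ∪ A) (∁ A))

  strong-map-gain : ∀ {n} (f g : Subset n → Carrier)
                  → Supermodular F g → StrongMap F f (dual F g)
                  → ∀ X Y → Nonempty Y → g Y - g (Y ─ X) ≤ f (X ∪ ∁ Y) - f (∁ Y)
  strong-map-gain f g g-sup strong X Y (e , e∈Y) = begin
    g Y - g (Y ─ X)    ≈⟨ value ⟨
    sumOver F W x      ≤⟨ strong A A⊂E x x∈P W (meet-disjoint-complement X Y) ⟩
    f (W ∪ A) - f A    ≡⟨ cong (λ U → f U - f A) (meet-join-complement X Y) ⟩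
    f (X ∪ ∁ Y) - f A  ∎
    where
    A = ∁ Y
    W = X ∩ Y
    A⊂E : A ⊂ ⊤
    A⊂E = ⊆⊤ , e , ∈⊤ , x∈p⇒x∉∁p e∈Y
    h : Subset _ → Carrier
    h Z = dual F g (Z ∪ A)
    open TightPoint (tight-point h (union-submodular (dual-submodular g-sup) A) W)
      renaming (point to x)
    x∈P : InContractionPolytope F (dual F g) A x
    x∈P Z _ = subst (λ S → sumOver F Z x ≤ h Z - dual F g S) (∪-identityˡ A) (bounded Z)
    value : sumOver F W x ≈ g Y - g (Y ─ X)
    value = begin-equality
      sumOver F W x                        ≈⟨ tight ⟩
      dual F g (W ∪ A) - dual F g (⊥ ∪ A)  ≈⟨ difference-of-duals (g ⊤) _ _ ⟩
      g (∁ (⊥ ∪ A)) - g (∁ (W ∪ A))        ≡⟨ cong₂ (λ U V → g U - g V)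
                                                (trans (cong ∁ (∪-identityˡ A)) (SubsetAlgebra.¬-involutive Y))
                                                (trans (complement-meet-join-complement X Y)
                                                         (sym (minus-as-meet Y X))) ⟩
      g Y - g (Y ─ X)                      ∎

  strong-map⇒gp : ∀ {n} (f g : Subset n → Carrier) → Submodular F f → Supermodular F g
                → StrongMap F f (dual F g) → GeneralizedPolymatroid F f g
  strong-map⇒gp f g f-sub g-sup strong X Y with nonempty? Y
  ... | yes Y≢∅ = exchange (≤-trans (strong-map-gain f g g-sup strong X Y Y≢∅) f-submodular)
    where
    f-submodular : f (X ∪ ∁ Y) - f (∁ Y) ≤ f X - f (X ─ Y)
    f-submodular = sum→difference
      (subst (λ U → f (X ∪ ∁ Y) + f U ≤ f X + f (∁ Y)) (sym (minus-as-meet X Y)) (f-sub X (∁ Y)))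
  ... | no Y≡∅ rewrite Empty-unique Y≡∅ =
    ≤-reflexive (reflexive (cong₂ (λ U V → f U - g V) (p─⊥≡p X) empty-minus))
    where
    empty-minus : ⊥ ─ X ≡ ⊥
    empty-minus = trans (minus-as-meet ⊥ X) (∩-zeroˡ (∁ X))

theorem2p2 : ∀ {c ℓ₁ ℓ₂ : Level} (F : OrderedField c ℓ₁ ℓ₂) (n : ℕ)
               (f g : Subset n → OrderedField.Carrier F)
             → Submodular F f → Supermodular F g
             → OrderedField._≈_ F (f ⊥) (OrderedField.0# F)
             → OrderedField._≈_ F (g ⊥) (OrderedField.0# F)
             → (GeneralizedPolymatroid F f g → StrongMap F f (dual F g))
               × (StrongMap F f (dual F g) → GeneralizedPolymatroid F f g)
theorem2p2 F n f g f-sub g-sup _ _ = gp⇒strong-map F f g , strong-map⇒gp F f g f-sub g-sup
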